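{- Let $w\in\mathcal L(\mathbf p)\setminus\{\varepsilon\}$ be a bispecial factor of $\mathbf p$. Then $w$ has one of the following forms: (A) $w_A^{(n)}=1\varphi^2(1)\varphi^4(1)\cdots\varphi^{2n}(1)\varphi^{2n-1}(0)\varphi^{2n-3}(0)\cdots\varphi(0)$ for some $n\ge1$, or $w_A^{(0)}=1$; the Parikh vector of $w_A^{(n)}$ equals that of $1\varphi(012)\varphi^3(012)\cdots\varphi^{2n-1}(012)$; (B) $w_B^{(n)}=\varphi(1)\varphi^3(1)\cdots\varphi^{2n+1}(1)\varphi^{2n}(0)\varphi^{2n-2}(0)\cdots\varphi^2(0)0$ for some $n\ge0$; its Parikh vector equals that of $012\varphi^2(012)\varphi^4(012)\cdots\varphi^{2n}(012)$; (C) $w_C^{(n)}=1\varphi^2(1)\varphi^4(1)\cdots\varphi^{2n}(1)\varphi^{2n}(0)\varphi^{2n-2}(0)\cdots\varphi^2(0)0$ for some $n\ge0$; its Parikh vector equals that of $01\varphi^2(01)\varphi^4(01)\cdots\varphi^{2n}(01)$; (D) $w_D^{(n)}=\varphi(1)\varphi^3(1)\cdots\varphi^{2n+1}(1)\varphi^{2n+1}(0)\varphi^{2n-1}(0)\cdots\varphi(0)$ for some $n\ge0$; its Parikh vector equals that of $\varphi(01)\varphi^3(01)\cdots\varphi^{2n+1}(01)$.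
   Context: $\varphi$ is the morphism on $\{0,1,2\}^*$ given by $\varphi(0)=01$, $\varphi(1)=21$, $\varphi(2)=0$, and $\mathbf p$ is its infinite fixed point starting with $0$. $\mathcal L(\mathbf p)$ is the set of finite factors of $\mathbf p$. A factor $w$ is bispecial if there are distinct letters $a,b$ with $aw,bw\in\mathcal L(\mathbf p)$ and distinct letters $c,d$ with $wc,wd\in\mathcal L(\mathbf p)$. The Parikh vector of a word over the ordered alphabet $\{0,1,2\}$ is the vector of numbers of occurrences of $0,1,2$. -}

module Defs where

open import Data.Nat using (ℕ; zero; suc; _+_; _*_)
open import Data.List using (List; []; _∷_; _++_; _∷ʳ_; concatMap; upTo; reverse; applyUpTo; length)
open import Data.Product using (_×_; _,_; ∃-syntax)
open import Relation.Binary.PropositionalEquality using (_≡_; _≢_)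

data Letter : Set where
  l0 l1 l2 : Letter

Word : Set
Word = List Letter

φₗ : Letter → Word
φₗ l0 = l0 ∷ l1 ∷ []
φₗ l1 = l2 ∷ l1 ∷ []
φₗ l2 = l0 ∷ []

φ : Word → Word
φ = concatMap φₗ

φ^ : ℕ → Word → Word
φ^ zero    w = w
φ^ (suc n) w = φ (φ^ n w)

-- i-th letter of a word (default l0 if out of range; never used below)
nth : ℕ → Word → Letter
nth _       []       = l0
nth zero    (a ∷ _)  = a
nth (suc i) (_ ∷ w)  = nth i w

-- The fixed point p = lim φ^k(0): its i-th letter is the i-th letter of
-- φ^(i+1)(0), which has length > i+1 and is a prefix of p.
p : ℕ → Letter
p i = nth i (φ^ (suc i) (l0 ∷ []))

slice : ℕ → ℕ → Word
slice i n = applyUpTo (λ j → p (i + j)) n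

Factor : Word → Set
Factor w = ∃[ i ] slice i (length w) ≡ w

Bispecial : Word → Set
Bispecial w =
  (∃[ a ] ∃[ b ] (a ≢ b × Factor (a ∷ w) × Factor (b ∷ w))) ×
  (∃[ c ] ∃[ d ] (c ≢ d × Factor (w ∷ʳ c) × Factor (w ∷ʳ d)))

count : Letter → Word → ℕ
count _  [] = 0
count l0 (l0 ∷ w) = suc (count l0 w)
count l1 (l1 ∷ w) = suc (count l1 w)
count l2 (l2 ∷ w) = suc (count l2 w)
count a  (_ ∷ w) = count a w

parikh : Word → ℕ × ℕ × ℕ
parikh w = count l0 w , count l1 w , count l2 w

w0 w1 w01 w012 : Word
w0 = l0 ∷ []
w1 = l1 ∷ []
w01 = l0 ∷ l1 ∷ []
w012 = l0 ∷ l1 ∷ l2 ∷ []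

-- concatMap f (upTo (suc n))           = f 0 f 1 ... f n
-- concatMap f (reverse (upTo (suc n))) = f n ... f 1 f 0

wA : ℕ → Word
wA n = concatMap (λ k → φ^ (2 * k) w1) (upTo (suc n))
    ++ concatMap (λ k → φ^ (2 * k + 1) w0) (reverse (upTo n))

pA : ℕ → Word
pA n = w1 ++ concatMap (λ k → φ^ (2 * k + 1) w012) (upTo n)

wB : ℕ → Word
wB n = concatMap (λ k → φ^ (2 * k + 1) w1) (upTo (suc n))
    ++ concatMap (λ k → φ^ (2 * k) w0) (reverse (upTo (suc n)))

pB : ℕ → Word
pB n = concatMap (λ k → φ^ (2 * k) w012) (upTo (suc n))

wC : ℕ → Word
wC n = concatMap (λ k → φ^ (2 * k) w1) (upTo (suc n))
    ++ concatMap (λ k → φ^ (2 * k) w0) (reverse (upTo (suc n)))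

pC : ℕ → Word
pC n = concatMap (λ k → φ^ (2 * k) w01) (upTo (suc n))

wD : ℕ → Word
wD n = concatMap (λ k → φ^ (2 * k + 1) w1) (upTo (suc n))
    ++ concatMap (λ k → φ^ (2 * k + 1) w0) (reverse (upTo (suc n)))

pD : ℕ → Word
pD n = concatMap (λ k → φ^ (2 * k + 1) w01) (upTo (suc n))

-- Every 0 or 2 of p starts a block φ(a) and every 1 ends one. Hence a bispecial factor w
-- other than 1 and 10 is ℓ·φ(v)·β with ℓ ∈ {ε, 1} and β ∈ {ε, 0}, and desubstituting the
-- extensions of w shows that v is a shorter bispecial factor which must be preceded by 1
-- (if ℓ = 1) or 2 (if ℓ = ε) and followed by 1 (if β = ε) or 0 (if β = 0). The words of
-- forms A, B, C, D begin with 1, 2, 1, 2 and end with 1, 0, 0, 1, so exactly one form of v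
-- survives, and w is the next term of the matching recurrence
--   wA (n+1) = 1 φ(wB n),  wB n = φ(wA n) 0,  wC (n+1) = 1 φ(wD n) 0,  wD n = φ(wC n).
-- The words pA, pB, pC, pD satisfy the same recurrences up to the order of letters.
module Submission where

open import Defs
open import Data.Empty using (⊥-elim)
open import Data.List using (List; []; _∷_; _++_; _∷ʳ_; [_]; length; concatMap; map; upTo; downFrom; applyUpTo; initLast; _∷ʳ′_)
open import Data.List.Properties using (∷-injective; ∷-injectiveʳ; ∷ʳ-injectiveʳ; ++-assoc; ++-identityʳ; length-++; concatMap-++; concatMap-map; concatMap-cong; map-upTo; map-downFrom; downFrom-∷ʳ; reverse-upTo)
open import Data.List.Relation.Unary.Linked using (Linked; []; [-]; _∷_; head; tail)
open import Data.Nat using (ℕ; zero; suc; _+_; _*_; _≤_; _<_; z≤n; s≤s)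
open import Data.Nat.Properties using (≤-refl; ≤-trans; ≤-pred; m≤n⇒m≤1+n; m≤m+n; m≤n+m; +-monoʳ-<; +-monoˡ-≤; module ≤-Reasoning; +-suc; +-comm; +-assoc; *-suc; <-≤-trans; <-trans; n<1+n; <⇒≤)
open import Data.Product using (_×_; _,_; ∃-syntax)
open import Data.Sum using (_⊎_; inj₁; inj₂)
open import Function using (_∘_)
open import Relation.Binary.PropositionalEquality using (_≡_; _≢_; refl; sym; trans; cong; cong₂; subst; module ≡-Reasoning)
open import Relation.Nullary using (¬_)
open import Relation.Binary.Bundles using (Setoid)
import Relation.Binary.Reasoning.Setoid as SetoidReasoning

φ-++ : ∀ u v → φ (u ++ v) ≡ φ u ++ φ v
φ-++ = concatMap-++ φₗ

φ-∷ʳ : ∀ u a → φ (u ∷ʳ a) ≡ φ u ++ φₗ a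
φ-∷ʳ u a = trans (φ-++ u [ a ]) (cong (φ u ++_) (++-identityʳ (φₗ a)))

φ-concatMap : ∀ {A : Set} (g : A → Word) xs → φ (concatMap g xs) ≡ concatMap (φ ∘ g) xs
φ-concatMap g []       = refl
φ-concatMap g (x ∷ xs) = trans (φ-++ (g x) (concatMap g xs)) (cong (φ (g x) ++_) (φ-concatMap g xs))

length-φ : ∀ u → length u ≤ length (φ u)
length-φ []       = z≤n
length-φ (l0 ∷ u) = m≤n⇒m≤1+n (s≤s (length-φ u))
length-φ (l1 ∷ u) = m≤n⇒m≤1+n (s≤s (length-φ u))
length-φ (l2 ∷ u) = s≤s (length-φ u)

length-φ-∷ʳ : ∀ v a → length (φₗ a) ≡ 2 → length (v ∷ʳ a) < length (φ (v ∷ʳ a))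
length-φ-∷ʳ v a ∣φₗa∣≡2 = begin-strict
  length (v ∷ʳ a)              ≡⟨ length-++ v ⟩
  length v + 1                 <⟨ +-monoʳ-< (length v) (s≤s (s≤s z≤n)) ⟩
  length v + 2                 ≤⟨ +-monoˡ-≤ 2 (length-φ v) ⟩
  length (φ v) + 2             ≡⟨ cong (length (φ v) +_) (sym ∣φₗa∣≡2) ⟩
  length (φ v) + length (φₗ a) ≡⟨ sym (length-++ (φ v)) ⟩
  length (φ v ++ φₗ a)         ≡⟨ cong length (sym (φ-∷ʳ v a)) ⟩
  length (φ (v ∷ʳ a))          ∎
  where open ≤-Reasoning

length-φ-ending-1 : ∀ v u → φ v ≡ u ∷ʳ l1 → length v < length (φ v)
length-φ-ending-1 v u e with initLast v
length-φ-ending-1 .[] []      () | []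
length-φ-ending-1 .[] (_ ∷ _) () | []
... | v′ ∷ʳ′ l0 = length-φ-∷ʳ v′ l0 refl
... | v′ ∷ʳ′ l1 = length-φ-∷ʳ v′ l1 refl
... | v′ ∷ʳ′ l2 with () ← ∷ʳ-injectiveʳ (φ v′) u (trans (sym (φ-∷ʳ v′ l2)) e)

Infix : Word → Word → Set
Infix u v = ∃[ s ] ∃[ t ] s ++ u ++ t ≡ v

Infix-trans : ∀ {u v x} → Infix u v → Infix v x → Infix u x
Infix-trans {u} (s , t , refl) (s′ , t′ , refl) = s′ ++ s , t ++ t′ , (begin
  (s′ ++ s) ++ u ++ t ++ t′   ≡⟨ ++-assoc s′ s (u ++ t ++ t′) ⟩
  s′ ++ s ++ u ++ t ++ t′     ≡⟨ cong (λ x → s′ ++ s ++ x) (sym (++-assoc u t t′)) ⟩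
  s′ ++ s ++ (u ++ t) ++ t′   ≡⟨ cong (s′ ++_) (sym (++-assoc s (u ++ t) t′)) ⟩
  s′ ++ (s ++ u ++ t) ++ t′   ∎)
  where open ≡-Reasoning

prefix-Infix : ∀ u t → Infix u (u ++ t)
prefix-Infix u t = [] , t , refl

suffix-Infix : ∀ s u → Infix u (s ++ u)
suffix-Infix s u = s , [] , cong (s ++_) (++-identityʳ u)

P : ℕ → Word
P k = φ^ k w0

Occurs : Word → Set
Occurs w = ∃[ k ] Infix w (P k)

Occurs-Infix : ∀ {u v} → Infix u v → Occurs v → Occurs u
Occurs-Infix u⊑v (k , v⊑P) = k , Infix-trans u⊑v v⊑P

Occurs-prefix : ∀ u t → Occurs (u ++ t) → Occurs u
Occurs-prefix u t = Occurs-Infix (prefix-Infix u t)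

Occurs-suffix : ∀ s u → Occurs (s ++ u) → Occurs u
Occurs-suffix s u = Occurs-Infix (suffix-Infix s u)

Occurs-φ : ∀ {w} → Occurs w → ∃[ k ] Infix w (φ (P k))
Occurs-φ (suc k , w⊑P) = k , w⊑P
Occurs-φ (zero  , w⊑P) = zero , Infix-trans w⊑P (prefix-Infix w0 w1)

P-head : ∀ k → ∃[ r ] P k ≡ l0 ∷ r
P-head zero    = [] , refl
P-head (suc k) with r , e ← P-head k = l1 ∷ φ r , cong φ e

P-prefix : ∀ {k K} → k ≤ K → ∃[ t ] P k ++ t ≡ P K
P-prefix {K = K} z≤n with r , e ← P-head K = r , sym e
P-prefix {suc k} (s≤s k≤K) with t , e ← P-prefix k≤K = φ t , trans (sym (φ-++ (P k) t)) (cong φ e)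

P-length : ∀ k → k < length (P k)
P-length zero    = s≤s z≤n
P-length (suc k) with r , e ← P-head k =
  subst (λ x → suc k < length (φ x)) (sym e)
        (s≤s (s≤s (≤-trans (≤-pred (subst (λ x → k < length x) e (P-length k))) (length-φ r))))

nth-++ : ∀ j u t → j < length u → nth j (u ++ t) ≡ nth j u
nth-++ zero    (x ∷ u) t _         = refl
nth-++ (suc j) (x ∷ u) t (s≤s j<u) = nth-++ j u t j<u

p-nth : ∀ {j K} → j < K → p j ≡ nth j (P K)
p-nth {j} j<K with t , e ← P-prefix j<K =
  trans (sym (nth-++ j (P (suc j)) t (<-trans (n<1+n j) (P-length (suc j))))) (cong (nth j) e)

applyUpTo-Infix : ∀ (f : ℕ → Letter) i n v → (∀ j → j < n → f j ≡ nth (i + j) v) → i + n ≤ length v →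
                  Infix (applyUpTo f n) v
applyUpTo-Infix f (suc i) n (x ∷ v) f≗v (s≤s i+n≤v)
  with s , t , e ← applyUpTo-Infix f i n v f≗v i+n≤v = x ∷ s , t , cong (x ∷_) e
applyUpTo-Infix f zero n v f≗v n≤v = [] , prefix f n v f≗v n≤v
  where
  prefix : ∀ (f : ℕ → Letter) n v → (∀ j → j < n → f j ≡ nth j v) → n ≤ length v → ∃[ t ] applyUpTo f n ++ t ≡ v
  prefix f zero    v       f≗v n≤v       = v , refl
  prefix f (suc n) (x ∷ v) f≗v (s≤s n≤v) with t , e ← prefix (f ∘ suc) n v (λ j → f≗v (suc j) ∘ s≤s) n≤v =
    t , cong₂ _∷_ (f≗v zero (s≤s z≤n)) e

Factor⇒Occurs : ∀ {w} → Factor w → Occurs w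
Factor⇒Occurs {w} (i , e) = K , subst (λ x → Infix x (P K)) e
  (applyUpTo-Infix (λ j → p (i + j)) i (length w) (P K)
     (λ j j<∣w∣ → p-nth (+-monoʳ-< i j<∣w∣)) (<⇒≤ (P-length K)))
  where K = i + length w

module _ {A : Set} {R : A → A → Set} where

  Linked-++⁻ˡ : ∀ u {t} → Linked R (u ++ t) → Linked R u
  Linked-++⁻ˡ []          _          = []
  Linked-++⁻ˡ (a ∷ [])    _          = [-]
  Linked-++⁻ˡ (a ∷ b ∷ u) (Rab ∷ bu) = Rab ∷ Linked-++⁻ˡ (b ∷ u) bu

  Linked-++⁻ʳ : ∀ s {u} → Linked R (s ++ u) → Linked R u
  Linked-++⁻ʳ []      su = su
  Linked-++⁻ʳ (a ∷ s) su = Linked-++⁻ʳ s (tail su)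

data Allowed : Letter → Letter → Set where
  a01 : Allowed l0 l1
  a02 : Allowed l0 l2
  a10 : Allowed l1 l0
  a12 : Allowed l1 l2
  a21 : Allowed l2 l1

Allowed-irrefl : ∀ {a} → ¬ Allowed a a
Allowed-irrefl ()

Admissible : Word → Set
Admissible = Linked Allowed

Admissible-φ : ∀ {u} → Admissible u → Admissible (φ u)
Admissible-φ []                = []
Admissible-φ ([-] {l0})        = a01 ∷ [-]
Admissible-φ ([-] {l1})        = a21 ∷ [-]
Admissible-φ ([-] {l2})        = [-]
Admissible-φ (a01 ∷ u)         = a01 ∷ a12 ∷ Admissible-φ u
Admissible-φ (a02 ∷ u)         = a01 ∷ a10 ∷ Admissible-φ u
Admissible-φ (a10 ∷ u)         = a21 ∷ a10 ∷ Admissible-φ u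
Admissible-φ (a12 ∷ u)         = a21 ∷ a10 ∷ Admissible-φ u
Admissible-φ (a21 ∷ u)         = a02 ∷ Admissible-φ u

Admissible-P : ∀ k → Admissible (P k)
Admissible-P zero    = [-]
Admissible-P (suc k) = Admissible-φ (Admissible-P k)

Admissible-suffix-P : ∀ k s m → P k ≡ s ++ m → Admissible m
Admissible-suffix-P k s m eq = Linked-++⁻ʳ s (subst Admissible eq (Admissible-P k))

Occurs⇒Admissible : ∀ {w} → Occurs w → Admissible w
Occurs⇒Admissible {w} (k , s , t , e) = Linked-++⁻ˡ w (Admissible-suffix-P k s (w ++ t) (sym e))

¬Occurs-square : ∀ a r → ¬ Occurs (a ∷ a ∷ r)
¬Occurs-square a r occ = Allowed-irrefl (head (Occurs⇒Admissible occ))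

Occurs-∷ʳ-Allowed : ∀ u x y → Occurs ((u ∷ʳ x) ∷ʳ y) → Allowed x y
Occurs-∷ʳ-Allowed u x y occ = head (Linked-++⁻ʳ u (subst Admissible (++-assoc u [ x ] [ y ]) (Occurs⇒Admissible occ)))

¬Occurs-square-end : ∀ a r → ¬ Occurs ((r ∷ʳ a) ∷ʳ a)
¬Occurs-square-end a r occ = Allowed-irrefl (Occurs-∷ʳ-Allowed r a a occ)

StartsWith : Letter → Word → Set
StartsWith a w = ∃[ r ] w ≡ a ∷ r

EndsWith : Letter → Word → Set
EndsWith a w = ∃[ r ] w ≡ r ∷ʳ a

-- 0 and 2 are exactly the first letters of the blocks φ(a), so an image φ(m) can only be
-- cut before a 0 or a 2, or at its end
data BlockStart : Word → Set where
  bs0 : ∀ {r} → BlockStart (l0 ∷ r)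
  bs2 : ∀ {r} → BlockStart (l2 ∷ r)

data Cut : Word → Set where
  end : Cut []
  at  : ∀ {r} → BlockStart r → Cut r

BlockStart-++ : ∀ {c} t → BlockStart c → BlockStart (c ++ t)
BlockStart-++ t bs0 = bs0
BlockStart-++ t bs2 = bs2

Cut-φ : ∀ m → Cut (φ m)
Cut-φ []       = end
Cut-φ (l0 ∷ m) = at bs0
Cut-φ (l1 ∷ m) = at bs2
Cut-φ (l2 ∷ m) = at bs0

¬φ≡1∷ : ∀ m r → φ m ≢ l1 ∷ r
¬φ≡1∷ m r e with at () ← subst Cut e (Cut-φ m)

φ-split : ∀ m L R → φ m ≡ L ++ R → Cut R →
          ∃[ m₁ ] ∃[ m₂ ] (m ≡ m₁ ++ m₂ × φ m₁ ≡ L × φ m₂ ≡ R)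
φ-split m        []       R e        _   = [] , m , refl , refl , e
φ-split (l0 ∷ m) (_ ∷ []) R refl     (at ())
φ-split (l1 ∷ m) (_ ∷ []) R refl     (at ())
φ-split (l0 ∷ m) (_ ∷ _ ∷ L) R e     cut with refl , e′ ← ∷-injective e
  with refl , e″ ← ∷-injective e′
  with m₁ , m₂ , refl , refl , f ← φ-split m L R e″ cut = l0 ∷ m₁ , m₂ , refl , refl , f
φ-split (l1 ∷ m) (_ ∷ _ ∷ L) R e     cut with refl , e′ ← ∷-injective e
  with refl , e″ ← ∷-injective e′
  with m₁ , m₂ , refl , refl , f ← φ-split m L R e″ cut = l1 ∷ m₁ , m₂ , refl , refl , f
φ-split (l2 ∷ m) (_ ∷ L) R e         cut with refl , e′ ← ∷-injective e
  with m₁ , m₂ , refl , refl , f ← φ-split m L R e′ cut = l2 ∷ m₁ , m₂ , refl , refl , f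

unφ : Word → Word
unφ []            = []
unφ (l0 ∷ l1 ∷ r) = l0 ∷ unφ r
unφ (l2 ∷ l1 ∷ r) = l1 ∷ unφ r
unφ (l0 ∷ r)      = l2 ∷ unφ r
unφ (_ ∷ r)       = unφ r

unφ-φ : ∀ m → unφ (φ m) ≡ m
unφ-φ []            = refl
unφ-φ (l0 ∷ m)      = cong (l0 ∷_) (unφ-φ m)
unφ-φ (l1 ∷ m)      = cong (l1 ∷_) (unφ-φ m)
unφ-φ (l2 ∷ [])     = refl
unφ-φ (l2 ∷ l0 ∷ m) = cong (l2 ∷_) (unφ-φ (l0 ∷ m))
unφ-φ (l2 ∷ l1 ∷ m) = cong (l2 ∷_) (unφ-φ (l1 ∷ m))
unφ-φ (l2 ∷ l2 ∷ m) = cong (l2 ∷_) (unφ-φ (l2 ∷ m))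

φ⁻¹-01∷ : ∀ m R → φ m ≡ l0 ∷ l1 ∷ R → ∃[ m′ ] (m ≡ l0 ∷ m′ × φ m′ ≡ R)
φ⁻¹-01∷ (l0 ∷ m) R e = m , refl , ∷-injectiveʳ (∷-injectiveʳ e)
φ⁻¹-01∷ (l2 ∷ m) R e = ⊥-elim (¬φ≡1∷ m R (∷-injectiveʳ e))

φ⁻¹-21∷ : ∀ m R → φ m ≡ l2 ∷ l1 ∷ R → ∃[ m′ ] (m ≡ l1 ∷ m′ × φ m′ ≡ R)
φ⁻¹-21∷ (l1 ∷ m) R e = m , refl , ∷-injectiveʳ (∷-injectiveʳ e)

φ⁻¹-∙1∷ : ∀ m y R → φ m ≡ y ∷ l1 ∷ R → ∃[ a ] ∃[ m′ ] (m ≡ a ∷ m′ × φ m′ ≡ R × (a ≡ l0 ⊎ a ≡ l1))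
φ⁻¹-∙1∷ (l0 ∷ m) y R e = l0 , m , refl , ∷-injectiveʳ (∷-injectiveʳ e) , inj₁ refl
φ⁻¹-∙1∷ (l1 ∷ m) y R e = l1 , m , refl , ∷-injectiveʳ (∷-injectiveʳ e) , inj₂ refl
φ⁻¹-∙1∷ (l2 ∷ m) y R e = ⊥-elim (¬φ≡1∷ m R (∷-injectiveʳ e))

φ⁻¹-0∷-cut : ∀ m R → φ m ≡ l0 ∷ R → Cut R → ∃[ m′ ] (m ≡ l2 ∷ m′ × φ m′ ≡ R)
φ⁻¹-0∷-cut (l2 ∷ m) R e _      = m , refl , ∷-injectiveʳ e
φ⁻¹-0∷-cut (l0 ∷ m) R e cut with at () ← subst Cut (sym (∷-injectiveʳ e)) cut

φ⁻¹-0∷ : ∀ m R → φ m ≡ l0 ∷ R → ∃[ a ] ∃[ m′ ] (m ≡ a ∷ m′ × (a ≡ l0 ⊎ a ≡ l2))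
φ⁻¹-0∷ (l0 ∷ m) R e = l0 , m , refl , inj₁ refl
φ⁻¹-0∷ (l2 ∷ m) R e = l2 , m , refl , inj₂ refl

φ⁻¹-2∷ : ∀ m R → φ m ≡ l2 ∷ R → ∃[ m′ ] m ≡ l1 ∷ m′
φ⁻¹-2∷ (l1 ∷ m) R e = m , refl

Cut-after-1 : ∀ c t → EndsWith l1 c → Admissible (c ++ t) → Cut t
Cut-after-1 .(c₀ ∷ʳ l1) t (c₀ , refl) ct
  with Linked-++⁻ʳ c₀ (subst Admissible (++-assoc c₀ [ l1 ] t) ct)
... | [-]     = end
... | a10 ∷ _ = at bs0
... | a12 ∷ _ = at bs2

Infix-φ-aligned : ∀ k {w} → Infix w (φ (P k)) → BlockStart w →
                  ∃[ m₁ ] ∃[ m₂ ] ∃[ t ] (P k ≡ m₁ ++ m₂ × φ m₂ ≡ w ++ t)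
Infix-φ-aligned k {w} (s , t , e) bs
  with m₁ , m₂ , eq , _ , f ← φ-split (P k) s (w ++ t) (sym e) (at (BlockStart-++ t bs)) = m₁ , m₂ , t , eq , f

Infix-φ-1∷ : ∀ k {u} → Infix (l1 ∷ u) (φ (P k)) → ∃[ y ] (BlockStart (y ∷ l1 ∷ u) × Infix (y ∷ l1 ∷ u) (φ (P k)))
Infix-φ-1∷ k {u} (s , t , e) with initLast s
... | []       = ⊥-elim (¬φ≡1∷ (P k) (u ++ t) (sym e))
... | s′ ∷ʳ′ y with e′ ← trans (sym (++-assoc s′ [ y ] (l1 ∷ u ++ t))) e
  with Linked-++⁻ʳ s′ (subst Admissible (sym e′) (Admissible-P (suc k)))
... | a01 ∷ _ = l0 , bs0 , s′ , t , e′
... | a21 ∷ _ = l2 , bs2 , s′ , t , e′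

unφ-after : ∀ k m₁ a m′ c t → P k ≡ m₁ ++ a ∷ m′ → φ m′ ≡ c ++ t → EndsWith l1 c →
            Occurs (a ∷ unφ c) × φ (unφ c) ≡ c
unφ-after k m₁ a m′ c t eq f c1
  with v , m₃ , refl , refl , _ ← φ-split m′ c t f
         (Cut-after-1 c t c1 (subst Admissible f (Admissible-φ (tail (Admissible-suffix-P k m₁ (a ∷ m′) eq)))))
  rewrite unφ-φ v = (k , m₁ , m₃ , sym eq) , refl

-- LeftLift₁ x a, LeftLift x a, RightLift₀ y a, RightLift y a: an occurrence of x·1·φ(v), x·φ(v),
-- φ(v)·0·y, φ(v)·y respectively comes from an occurrence of a·v, a·v, v·a, v·a
data LeftLift₁ : Letter → Letter → Set where
  0↦0 : LeftLift₁ l0 l0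
  2↦1 : LeftLift₁ l2 l1

data LeftLift : Letter → Letter → Set where
  0↦2 : LeftLift l0 l2
  1↦0 : LeftLift l1 l0
  1↦1 : LeftLift l1 l1

data RightLift₀ : Letter → Letter → Set where
  1↦0 : RightLift₀ l1 l0
  2↦2 : RightLift₀ l2 l2

data RightLift : Letter → Letter → Set where
  2↦1 : RightLift l2 l1
  0↦0 : RightLift l0 l0
  0↦2 : RightLift l0 l2

LeftLifted : (Letter → Letter → Set) → Letter → Word → Set
LeftLifted L x c = ∃[ a ] (L x a × Occurs (a ∷ unφ c) × φ (unφ c) ≡ c)

RightLifted : (Letter → Letter → Set) → Letter → Word → Set
RightLifted R y c = ∃[ a ] (R y a × Occurs (unφ c ∷ʳ a) × φ (unφ c) ≡ c)

lift-x1∙ : ∀ x c → Occurs (x ∷ l1 ∷ c) → EndsWith l1 c → LeftLifted LeftLift₁ x c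
lift-x1∙ l1 c occ _ = ⊥-elim (¬Occurs-square l1 c occ)
lift-x1∙ l0 c occ c1 with k , inf ← Occurs-φ occ
  with m₁ , m₂ , t , eq , f ← Infix-φ-aligned k inf bs0
  with m′ , refl , g ← φ⁻¹-01∷ m₂ (c ++ t) f = l0 , 0↦0 , unφ-after k m₁ l0 m′ c t eq g c1
lift-x1∙ l2 c occ c1 with k , inf ← Occurs-φ occ
  with m₁ , m₂ , t , eq , f ← Infix-φ-aligned k inf bs2
  with m′ , refl , g ← φ⁻¹-21∷ m₂ (c ++ t) f = l1 , 2↦1 , unφ-after k m₁ l1 m′ c t eq g c1

lift-x∙ : ∀ x c → Occurs (x ∷ c) → BlockStart c → EndsWith l1 c → LeftLifted LeftLift x c
lift-x∙ l2 c occ bs0 _ with () ← head (Occurs⇒Admissible occ)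
lift-x∙ l2 c occ bs2 _ with () ← head (Occurs⇒Admissible occ)
lift-x∙ l0 c occ bs c1 with k , inf ← Occurs-φ occ
  with m₁ , m₂ , t , eq , f ← Infix-φ-aligned k inf bs0
  with m′ , refl , g ← φ⁻¹-0∷-cut m₂ (c ++ t) f (at (BlockStart-++ t bs)) = l2 , 0↦2 , unφ-after k m₁ l2 m′ c t eq g c1
lift-x∙ l1 c occ bs c1 with k , inf ← Occurs-φ occ
  with y , bsy , inf′ ← Infix-φ-1∷ k inf
  with m₁ , m₂ , t , eq , f ← Infix-φ-aligned k inf′ bsy
  with φ⁻¹-∙1∷ m₂ y (c ++ t) f
... | a , m′ , refl , g , inj₁ refl = l0 , 1↦0 , unφ-after k m₁ l0 m′ c t eq g c1
... | a , m′ , refl , g , inj₂ refl = l1 , 1↦1 , unφ-after k m₁ l1 m′ c t eq g c1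

Infix-φ-aligned₂ : ∀ k {c d} → Infix (c ++ d) (φ (P k)) → BlockStart c → BlockStart d →
                   ∃[ m₁ ] ∃[ v ] ∃[ m₃ ] ∃[ t ] (P k ≡ m₁ ++ v ++ m₃ × φ v ≡ c × φ m₃ ≡ d ++ t)
Infix-φ-aligned₂ k {c} {d} inf bsc bsd
  with m₁ , m₂ , t , eq , f ← Infix-φ-aligned k inf (BlockStart-++ d bsc)
  with v , m₃ , refl , φv≡c , g ← φ-split m₂ c (d ++ t) (trans f (++-assoc c d t)) (at (BlockStart-++ t bsd))
  = m₁ , v , m₃ , t , eq , φv≡c , g

unφ-before : ∀ k m₁ v a m₄ {c} → P k ≡ m₁ ++ v ++ a ∷ m₄ → φ v ≡ c → Occurs (unφ c ∷ʳ a) × φ (unφ c) ≡ c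
unφ-before k m₁ v a m₄ eq refl rewrite unφ-φ v =
  (k , m₁ , m₄ , trans (cong (m₁ ++_) (++-assoc v [ a ] m₄)) (sym eq)) , refl

lift-∙0y : ∀ y c → Occurs (c ++ l0 ∷ y ∷ []) → BlockStart c → RightLifted RightLift₀ y c
lift-∙0y l0 c occ _ with () ← head (Linked-++⁻ʳ c (Occurs⇒Admissible occ))
lift-∙0y l1 c occ bs with k , inf ← Occurs-φ occ
  with m₁ , v , m₃ , t , eq , φv≡c , g ← Infix-φ-aligned₂ k inf bs bs0
  with m₄ , refl , _ ← φ⁻¹-01∷ m₃ t g = l0 , 1↦0 , unφ-before k m₁ v l0 m₄ eq φv≡c
lift-∙0y l2 c occ bs with k , inf ← Occurs-φ occ
  with m₁ , v , m₃ , t , eq , φv≡c , g ← Infix-φ-aligned₂ k inf bs bs0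
  with m₄ , refl , _ ← φ⁻¹-0∷-cut m₃ (l2 ∷ t) g (at bs2) = l2 , 2↦2 , unφ-before k m₁ v l2 m₄ eq φv≡c

lift-∙y : ∀ y c → Occurs (c ∷ʳ y) → BlockStart c → EndsWith l1 c → RightLifted RightLift y c
lift-∙y l1 c occ _ (c₀ , refl) = ⊥-elim (¬Occurs-square-end l1 c₀ occ)
lift-∙y l2 c occ bs _ with k , inf ← Occurs-φ occ
  with m₁ , v , m₃ , t , eq , φv≡c , g ← Infix-φ-aligned₂ k inf bs bs2
  with m₄ , refl ← φ⁻¹-2∷ m₃ t g = l1 , 2↦1 , unφ-before k m₁ v l1 m₄ eq φv≡c
lift-∙y l0 c occ bs _ with k , inf ← Occurs-φ occ
  with m₁ , v , m₃ , t , eq , φv≡c , g ← Infix-φ-aligned₂ k inf bs bs0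
  with φ⁻¹-0∷ m₃ t g
... | a , m₄ , refl , inj₁ refl = l0 , 0↦0 , unφ-before k m₁ v l0 m₄ eq φv≡c
... | a , m₄ , refl , inj₂ refl = l2 , 0↦2 , unφ-before k m₁ v l2 m₄ eq φv≡c

LeftSpecial : Word → Set
LeftSpecial w = ∃[ a ] ∃[ b ] (a ≢ b × Occurs (a ∷ w) × Occurs (b ∷ w))

RightSpecial : Word → Set
RightSpecial w = ∃[ a ] ∃[ b ] (a ≢ b × Occurs (w ∷ʳ a) × Occurs (w ∷ʳ b))

-- A bispecial w ∉ {1, 10} is ℓ·φ(v)·β; the margins ℓ and β force the letters z that
-- may precede, respectively follow, v.
data LeftMargin : Word → Letter → Set where
  none : LeftMargin [] l2
  one  : LeftMargin [ l1 ] l1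

data RightMargin : Word → Letter → Set where
  none : RightMargin [] l1
  zero : RightMargin [ l0 ] l0

LeftSpecial-lift : ∀ {ℓ z} c β → LeftMargin ℓ z → BlockStart c → EndsWith l1 c → LeftSpecial (ℓ ++ c ++ β) →
                   (LeftSpecial (unφ c) × Occurs (z ∷ unφ c)) × φ (unφ c) ≡ c
LeftSpecial-lift c β one bs c1 (a , b , a≢b , occa , occb)
  with lift-x1∙ a c (Occurs-prefix (a ∷ l1 ∷ c) β occa) c1 | lift-x1∙ b c (Occurs-prefix (b ∷ l1 ∷ c) β occb) c1
... | _ , 0↦0 , oa , e | _ , 2↦1 , ob , _ = ((l0 , l1 , (λ ()) , oa , ob) , ob) , e
... | _ , 2↦1 , oa , e | _ , 0↦0 , ob , _ = ((l1 , l0 , (λ ()) , oa , ob) , oa) , e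
... | _ , 0↦0 , _  , _ | _ , 0↦0 , _  , _ = ⊥-elim (a≢b refl)
... | _ , 2↦1 , _  , _ | _ , 2↦1 , _  , _ = ⊥-elim (a≢b refl)
LeftSpecial-lift c β none bs c1 (a , b , a≢b , occa , occb)
  with lift-x∙ a c (Occurs-prefix (a ∷ c) β occa) bs c1 | lift-x∙ b c (Occurs-prefix (b ∷ c) β occb) bs c1
... | _ , 0↦2 , oa , e | _ , 1↦0 , ob , _ = ((l2 , l0 , (λ ()) , oa , ob) , oa) , e
... | _ , 0↦2 , oa , e | _ , 1↦1 , ob , _ = ((l2 , l1 , (λ ()) , oa , ob) , oa) , e
... | _ , 1↦0 , oa , e | _ , 0↦2 , ob , _ = ((l0 , l2 , (λ ()) , oa , ob) , ob) , e
... | _ , 1↦1 , oa , e | _ , 0↦2 , ob , _ = ((l1 , l2 , (λ ()) , oa , ob) , ob) , e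
... | _ , 0↦2 , _  , _ | _ , 0↦2 , _  , _ = ⊥-elim (a≢b refl)
... | _ , 1↦0 , _  , _ | _ , 1↦0 , _  , _ = ⊥-elim (a≢b refl)
... | _ , 1↦0 , _  , _ | _ , 1↦1 , _  , _ = ⊥-elim (a≢b refl)
... | _ , 1↦1 , _  , _ | _ , 1↦0 , _  , _ = ⊥-elim (a≢b refl)
... | _ , 1↦1 , _  , _ | _ , 1↦1 , _  , _ = ⊥-elim (a≢b refl)

Occurs-drop-left-margin : ∀ ℓ u y → Occurs ((ℓ ++ u) ∷ʳ y) → Occurs (u ∷ʳ y)
Occurs-drop-left-margin ℓ u y occ = Occurs-suffix ℓ (u ∷ʳ y) (subst Occurs (++-assoc ℓ u [ y ]) occ)

RightSpecial-lift : ∀ {β z} ℓ c → RightMargin β z → BlockStart c → EndsWith l1 c → RightSpecial (ℓ ++ c ++ β) →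
                    RightSpecial (unφ c) × Occurs (unφ c ∷ʳ z)
RightSpecial-lift ℓ c zero bs c1 (a , b , a≢b , occa , occb)
  with lift-∙0y a c (subst Occurs (++-assoc c [ l0 ] [ a ]) (Occurs-drop-left-margin ℓ _ a occa)) bs
     | lift-∙0y b c (subst Occurs (++-assoc c [ l0 ] [ b ]) (Occurs-drop-left-margin ℓ _ b occb)) bs
... | _ , 1↦0 , oa , _ | _ , 2↦2 , ob , _ = (l0 , l2 , (λ ()) , oa , ob) , oa
... | _ , 2↦2 , oa , _ | _ , 1↦0 , ob , _ = (l2 , l0 , (λ ()) , oa , ob) , ob
... | _ , 1↦0 , _  , _ | _ , 1↦0 , _  , _ = ⊥-elim (a≢b refl)
... | _ , 2↦2 , _  , _ | _ , 2↦2 , _  , _ = ⊥-elim (a≢b refl)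
RightSpecial-lift ℓ c none bs c1 (a , b , a≢b , occa , occb)
  with lift-∙y a c (subst (λ u → Occurs (u ∷ʳ a)) (++-identityʳ c) (Occurs-drop-left-margin ℓ _ a occa)) bs c1
     | lift-∙y b c (subst (λ u → Occurs (u ∷ʳ b)) (++-identityʳ c) (Occurs-drop-left-margin ℓ _ b occb)) bs c1
... | _ , 2↦1 , oa , _ | _ , 0↦0 , ob , _ = (l1 , l0 , (λ ()) , oa , ob) , oa
... | _ , 2↦1 , oa , _ | _ , 0↦2 , ob , _ = (l1 , l2 , (λ ()) , oa , ob) , oa
... | _ , 0↦0 , oa , _ | _ , 2↦1 , ob , _ = (l0 , l1 , (λ ()) , oa , ob) , ob
... | _ , 0↦2 , oa , _ | _ , 2↦1 , ob , _ = (l2 , l1 , (λ ()) , oa , ob) , ob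
... | _ , 2↦1 , _  , _ | _ , 2↦1 , _  , _ = ⊥-elim (a≢b refl)
... | _ , 0↦0 , _  , _ | _ , 0↦0 , _  , _ = ⊥-elim (a≢b refl)
... | _ , 0↦0 , _  , _ | _ , 0↦2 , _  , _ = ⊥-elim (a≢b refl)
... | _ , 0↦2 , _  , _ | _ , 0↦0 , _  , _ = ⊥-elim (a≢b refl)
... | _ , 0↦2 , _  , _ | _ , 0↦2 , _  , _ = ⊥-elim (a≢b refl)

data Shape : Word → Set where
  ⟨1⟩     : Shape [ l1 ]
  ⟨10⟩    : Shape (l1 ∷ l0 ∷ [])
  margins : ∀ {ℓ z₁ β z₂} c → LeftMargin ℓ z₁ → RightMargin β z₂ → BlockStart c → EndsWith l1 c →
            Shape (ℓ ++ c ++ β)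

right-shape : ∀ u → BlockStart u → RightSpecial u →
              u ≡ [ l0 ] ⊎ ∃[ c ] ∃[ β ] ∃[ z ] (RightMargin β z × BlockStart c × EndsWith l1 c × u ≡ c ++ β)
right-shape u bs (a , b , a≢b , occa , occb) with initLast u
... | [] with () ← bs
... | c ∷ʳ′ l1 = inj₂ (c ∷ʳ l1 , [] , l1 , none , bs , (c , refl) , sym (++-identityʳ _))
... | u₀ ∷ʳ′ l2 with Occurs-∷ʳ-Allowed u₀ l2 a occa | Occurs-∷ʳ-Allowed u₀ l2 b occb
...   | a21 | a21 = ⊥-elim (a≢b refl)
right-shape u bs (a , b , a≢b , occa , occb) | u₀ ∷ʳ′ l0 with initLast u₀
... | [] = inj₁ refl
... | u₁ ∷ʳ′ h with Occurs-∷ʳ-Allowed u₁ h l0 (Occurs-prefix _ [ a ] occa)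
...   | a10 = inj₂ (u₁ ∷ʳ l1 , [ l0 ] , l0 , zero , BlockStart-++⁻ u₁ bs , (u₁ , refl) , refl)
  where
  BlockStart-++⁻ : ∀ u → BlockStart ((u ∷ʳ l1) ∷ʳ l0) → BlockStart (u ∷ʳ l1)
  BlockStart-++⁻ (_ ∷ _) bs0 = bs0
  BlockStart-++⁻ (_ ∷ _) bs2 = bs2

bispecial-shape : ∀ w → w ≢ [] → LeftSpecial w → RightSpecial w → Shape w
bispecial-shape []  w≢[] _ _ = ⊥-elim (w≢[] refl)
bispecial-shape (l0 ∷ r) _ (a , b , a≢b , occa , occb) _
  with head (Occurs⇒Admissible occa) | head (Occurs⇒Admissible occb)
... | a10 | a10 = ⊥-elim (a≢b refl)
bispecial-shape (l1 ∷ []) _ _ _ = ⟨1⟩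
bispecial-shape (l1 ∷ l1 ∷ r) _ (a , _ , _ , occa , _) _ = ⊥-elim (¬Occurs-square l1 r (Occurs-suffix [ a ] _ occa))
bispecial-shape (l1 ∷ l0 ∷ r) _ _ (a , b , a≢b , occa , occb)
  with right-shape (l0 ∷ r) bs0 (a , b , a≢b , Occurs-suffix [ l1 ] _ occa , Occurs-suffix [ l1 ] _ occb)
... | inj₁ refl = ⟨10⟩
... | inj₂ (c , β , _ , m , bs , c1 , e) = subst (Shape ∘ (l1 ∷_)) (sym e) (margins c one m bs c1)
bispecial-shape (l1 ∷ l2 ∷ r) _ _ (a , b , a≢b , occa , occb)
  with right-shape (l2 ∷ r) bs2 (a , b , a≢b , Occurs-suffix [ l1 ] _ occa , Occurs-suffix [ l1 ] _ occb)
... | inj₂ (c , β , _ , m , bs , c1 , e) = subst (Shape ∘ (l1 ∷_)) (sym e) (margins c one m bs c1)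
bispecial-shape (l2 ∷ r) _ _ rs with right-shape (l2 ∷ r) bs2 rs
... | inj₂ (c , β , _ , m , bs , c1 , e) = subst Shape (sym e) (margins c none m bs c1)

evenPowers oddPowers : Word → List ℕ → Word
evenPowers w = concatMap (λ k → φ^ (2 * k) w)
oddPowers  w = concatMap (λ k → φ^ (2 * k + 1) w)

oddPowers-φ : ∀ w ks → oddPowers w ks ≡ φ (evenPowers w ks)
oddPowers-φ w ks = sym (trans (φ-concatMap _ ks) (concatMap-cong (λ k → cong (λ i → φ^ i w) (+-comm 1 (2 * k))) ks))

φ-oddPowers : ∀ w ks → φ (oddPowers w ks) ≡ evenPowers w (map suc ks)
φ-oddPowers w ks = begin
  φ (oddPowers w ks)                                ≡⟨ φ-concatMap _ ks ⟩
  concatMap (λ k → φ^ (suc (2 * k + 1)) w) ks       ≡⟨ concatMap-cong (λ k → cong (λ i → φ^ i w) (index k)) ks ⟩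
  concatMap (λ k → φ^ (2 * suc k) w) ks             ≡⟨ concatMap-map _ suc ks ⟨
  evenPowers w (map suc ks)                         ∎
  where
  open ≡-Reasoning
  index : ∀ k → suc (2 * k + 1) ≡ 2 * suc k
  index k = trans (cong suc (+-comm (2 * k) 1)) (sym (*-suc 2 k))

upTo-suc : ∀ n → upTo (suc n) ≡ 0 ∷ map suc (upTo n)
upTo-suc n = cong (0 ∷_) (sym (map-upTo suc n))

downFrom-suc : ∀ n → downFrom (suc n) ≡ map suc (downFrom n) ∷ʳ 0
downFrom-suc n = trans (sym (downFrom-∷ʳ n)) (cong (_∷ʳ 0) (sym (map-downFrom suc n)))

concatMap-∷ʳ : ∀ {A : Set} (g : A → Word) xs x → concatMap g (xs ∷ʳ x) ≡ concatMap g xs ++ g x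
concatMap-∷ʳ g xs x = trans (concatMap-++ g xs [ x ]) (cong (concatMap g xs ++_) (++-identityʳ (g x)))

evenPowers-upTo-suc : ∀ w n → evenPowers w (upTo (suc n)) ≡ w ++ φ (oddPowers w (upTo n))
evenPowers-upTo-suc w n = trans (cong (evenPowers w) (upTo-suc n))
                                (cong (w ++_) (sym (φ-oddPowers w (upTo n))))

evenPowers-downFrom-suc : ∀ w n → evenPowers w (downFrom (suc n)) ≡ φ (oddPowers w (downFrom n)) ++ w
evenPowers-downFrom-suc w n = begin
  evenPowers w (downFrom (suc n))             ≡⟨ cong (evenPowers w) (downFrom-suc n) ⟩
  evenPowers w (map suc (downFrom n) ∷ʳ 0)    ≡⟨ concatMap-∷ʳ _ (map suc (downFrom n)) 0 ⟩
  evenPowers w (map suc (downFrom n)) ++ w    ≡⟨ cong (_++ w) (φ-oddPowers w (downFrom n)) ⟨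
  φ (oddPowers w (downFrom n)) ++ w           ∎
  where open ≡-Reasoning

wA-downFrom : ∀ n → wA n ≡ evenPowers w1 (upTo (suc n)) ++ oddPowers w0 (downFrom n)
wA-downFrom n = cong (λ ks → evenPowers w1 (upTo (suc n)) ++ oddPowers w0 ks) (reverse-upTo n)

wB-downFrom : ∀ n → wB n ≡ oddPowers w1 (upTo (suc n)) ++ evenPowers w0 (downFrom (suc n))
wB-downFrom n = cong (λ ks → oddPowers w1 (upTo (suc n)) ++ evenPowers w0 ks) (reverse-upTo (suc n))

wC-downFrom : ∀ n → wC n ≡ evenPowers w1 (upTo (suc n)) ++ evenPowers w0 (downFrom (suc n))
wC-downFrom n = cong (λ ks → evenPowers w1 (upTo (suc n)) ++ evenPowers w0 ks) (reverse-upTo (suc n))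

wD-downFrom : ∀ n → wD n ≡ oddPowers w1 (upTo (suc n)) ++ oddPowers w0 (downFrom (suc n))
wD-downFrom n = cong (λ ks → oddPowers w1 (upTo (suc n)) ++ oddPowers w0 ks) (reverse-upTo (suc n))

wB≡φwA∙0 : ∀ n → wB n ≡ φ (wA n) ++ w0
wB≡φwA∙0 n = begin
  wB n                                                       ≡⟨ wB-downFrom n ⟩
  oddPowers w1 (upTo (suc n)) ++ evenPowers w0 (downFrom (suc n))
    ≡⟨ cong₂ _++_ (oddPowers-φ w1 (upTo (suc n))) (evenPowers-downFrom-suc w0 n) ⟩
  φ E ++ (φ O ++ w0)                                         ≡⟨ ++-assoc (φ E) (φ O) w0 ⟨
  (φ E ++ φ O) ++ w0                                         ≡⟨ cong (_++ w0) (φ-++ E O) ⟨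
  φ (E ++ O) ++ w0                                           ≡⟨ cong (λ x → φ x ++ w0) (wA-downFrom n) ⟨
  φ (wA n) ++ w0                                             ∎
  where
  open ≡-Reasoning
  E = evenPowers w1 (upTo (suc n))
  O = oddPowers w0 (downFrom n)

wA-suc≡1∙φwB : ∀ n → wA (suc n) ≡ l1 ∷ φ (wB n)
wA-suc≡1∙φwB n = begin
  wA (suc n)                                                 ≡⟨ wA-downFrom (suc n) ⟩
  evenPowers w1 (upTo (suc (suc n))) ++ oddPowers w0 (downFrom (suc n))
    ≡⟨ cong₂ _++_ (evenPowers-upTo-suc w1 (suc n)) (oddPowers-φ w0 (downFrom (suc n))) ⟩
  l1 ∷ φ O ++ φ E                                            ≡⟨ cong (l1 ∷_) (φ-++ O E) ⟨
  l1 ∷ φ (O ++ E)                                            ≡⟨ cong (λ x → l1 ∷ φ x) (wB-downFrom n) ⟨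
  l1 ∷ φ (wB n)                                              ∎
  where
  open ≡-Reasoning
  O = oddPowers w1 (upTo (suc n))
  E = evenPowers w0 (downFrom (suc n))

wD≡φwC : ∀ n → wD n ≡ φ (wC n)
wD≡φwC n = begin
  wD n                                                       ≡⟨ wD-downFrom n ⟩
  oddPowers w1 (upTo (suc n)) ++ oddPowers w0 (downFrom (suc n))
    ≡⟨ cong₂ _++_ (oddPowers-φ w1 (upTo (suc n))) (oddPowers-φ w0 (downFrom (suc n))) ⟩
  φ E₁ ++ φ E₀                                               ≡⟨ φ-++ E₁ E₀ ⟨
  φ (E₁ ++ E₀)                                               ≡⟨ cong φ (wC-downFrom n) ⟨
  φ (wC n)                                                   ∎
  where
  open ≡-Reasoning
  E₁ = evenPowers w1 (upTo (suc n))
  E₀ = evenPowers w0 (downFrom (suc n))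

wC-suc≡1∙φwD∙0 : ∀ n → wC (suc n) ≡ l1 ∷ φ (wD n) ++ w0
wC-suc≡1∙φwD∙0 n = begin
  wC (suc n)                                                 ≡⟨ wC-downFrom (suc n) ⟩
  evenPowers w1 (upTo (suc (suc n))) ++ evenPowers w0 (downFrom (suc (suc n)))
    ≡⟨ cong₂ _++_ (evenPowers-upTo-suc w1 (suc n)) (evenPowers-downFrom-suc w0 (suc n)) ⟩
  l1 ∷ φ O₁ ++ (φ O₀ ++ w0)                                  ≡⟨ cong (l1 ∷_) (++-assoc (φ O₁) (φ O₀) w0) ⟨
  l1 ∷ (φ O₁ ++ φ O₀) ++ w0                                  ≡⟨ cong (λ x → l1 ∷ x ++ w0) (φ-++ O₁ O₀) ⟨
  l1 ∷ φ (O₁ ++ O₀) ++ w0                                    ≡⟨ cong (λ x → l1 ∷ φ x ++ w0) (wD-downFrom n) ⟨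
  l1 ∷ φ (wD n) ++ w0                                        ∎
  where
  open ≡-Reasoning
  O₁ = oddPowers w1 (upTo (suc n))
  O₀ = oddPowers w0 (downFrom (suc n))

pA-suc≡1∙φpB : ∀ n → pA (suc n) ≡ l1 ∷ φ (pB n)
pA-suc≡1∙φpB n = cong (l1 ∷_) (oddPowers-φ w012 (upTo (suc n)))

pB-suc≡012∙φφpB : ∀ n → pB (suc n) ≡ w012 ++ φ (φ (pB n))
pB-suc≡012∙φφpB n = trans (evenPowers-upTo-suc w012 (suc n)) (cong (λ x → w012 ++ φ x) (oddPowers-φ w012 (upTo (suc n))))

pD≡φpC : ∀ n → pD n ≡ φ (pC n)
pD≡φpC n = oddPowers-φ w01 (upTo (suc n))

pC-suc≡01∙φpD : ∀ n → pC (suc n) ≡ w01 ++ φ (pD n)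
pC-suc≡01∙φpD n = evenPowers-upTo-suc w01 (suc n)

StartsWith-++ : ∀ {a u} t → StartsWith a u → StartsWith a (u ++ t)
StartsWith-++ t (r , refl) = r ++ t , refl

φ-StartsWith-1 : ∀ {u} → StartsWith l1 u → StartsWith l2 (φ u)
φ-StartsWith-1 (r , refl) = l1 ∷ φ r , refl

φ-EndsWith-0 : ∀ {u} → EndsWith l0 u → EndsWith l1 (φ u)
φ-EndsWith-0 (r , refl) = φ r ++ w0 , trans (φ-∷ʳ r l0) (sym (++-assoc (φ r) w0 w1))

wA-head : ∀ n → StartsWith l1 (wA n)
wA-head zero    = [] , refl
wA-head (suc n) = φ (wB n) , wA-suc≡1∙φwB n

wB-head : ∀ n → StartsWith l2 (wB n)
wB-head n = subst (StartsWith l2) (sym (wB≡φwA∙0 n)) (StartsWith-++ w0 (φ-StartsWith-1 (wA-head n)))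

wC-head : ∀ n → StartsWith l1 (wC n)
wC-head zero    = w0 , refl
wC-head (suc n) = φ (wD n) ++ w0 , wC-suc≡1∙φwD∙0 n

wD-head : ∀ n → StartsWith l2 (wD n)
wD-head n = subst (StartsWith l2) (sym (wD≡φwC n)) (φ-StartsWith-1 (wC-head n))

wB-last : ∀ n → EndsWith l0 (wB n)
wB-last n = φ (wA n) , wB≡φwA∙0 n

wA-last : ∀ n → EndsWith l1 (wA n)
wA-last zero    = [] , refl
wA-last (suc n) with r , e ← φ-EndsWith-0 (wB-last n) = l1 ∷ r , trans (wA-suc≡1∙φwB n) (cong (l1 ∷_) e)

wC-last : ∀ n → EndsWith l0 (wC n)
wC-last zero    = w1 , refl
wC-last (suc n) = l1 ∷ φ (wD n) , wC-suc≡1∙φwD∙0 n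

wD-last : ∀ n → EndsWith l1 (wD n)
wD-last n = subst (EndsWith l1) (sym (wD≡φwC n)) (φ-EndsWith-0 (wC-last n))

¬Occurs-before-head : ∀ {a v} → StartsWith a v → ¬ Occurs (a ∷ v)
¬Occurs-before-head {a} (r , refl) = ¬Occurs-square a r

¬Occurs-after-last : ∀ {a v} → EndsWith a v → ¬ Occurs (v ∷ʳ a)
¬Occurs-after-last {a} (r , refl) = ¬Occurs-square-end a r

data Form : Word → Set where
  A : ∀ n → Form (wA n)
  B : ∀ n → Form (wB n)
  C : ∀ n → Form (wC n)
  D : ∀ n → Form (wD n)

-- the extension letters forced by the margins single out the form of v, and ℓ·φ(v)·β is the next one
Form-φ : ∀ {ℓ z₁ β z₂ v} → LeftMargin ℓ z₁ → RightMargin β z₂ → Form v → Occurs (z₁ ∷ v) → Occurs (v ∷ʳ z₂) →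
         Form (ℓ ++ φ v ++ β)
Form-φ one  none (B n) _ _ = subst Form (trans (wA-suc≡1∙φwB n) (cong (l1 ∷_) (sym (++-identityʳ _)))) (A (suc n))
Form-φ one  zero (D n) _ _ = subst Form (wC-suc≡1∙φwD∙0 n) (C (suc n))
Form-φ none none (C n) _ _ = subst Form (trans (wD≡φwC n) (sym (++-identityʳ _))) (D n)
Form-φ none zero (A n) _ _ = subst Form (wB≡φwA∙0 n) (B n)
Form-φ one  _    (A n) occ _ = ⊥-elim (¬Occurs-before-head (wA-head n) occ)
Form-φ one  _    (C n) occ _ = ⊥-elim (¬Occurs-before-head (wC-head n) occ)
Form-φ none _    (B n) occ _ = ⊥-elim (¬Occurs-before-head (wB-head n) occ)
Form-φ none _    (D n) occ _ = ⊥-elim (¬Occurs-before-head (wD-head n) occ)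
Form-φ one  none (D n) _ occ = ⊥-elim (¬Occurs-after-last (wD-last n) occ)
Form-φ one  zero (B n) _ occ = ⊥-elim (¬Occurs-after-last (wB-last n) occ)
Form-φ none none (A n) _ occ = ⊥-elim (¬Occurs-after-last (wA-last n) occ)
Form-φ none zero (C n) _ occ = ⊥-elim (¬Occurs-after-last (wC-last n) occ)

length-Infix : ∀ {u v} → Infix u v → length u ≤ length v
length-Infix {u} (s , t , refl) = begin
  length u                       ≤⟨ m≤m+n (length u) (length t) ⟩
  length u + length t            ≡⟨ length-++ u ⟨
  length (u ++ t)                ≤⟨ m≤n+m (length (u ++ t)) (length s) ⟩
  length s + length (u ++ t)     ≡⟨ length-++ s ⟨
  length (s ++ u ++ t)           ∎
  where open ≤-Reasoning

EndsWith⇒≢[] : ∀ {a w} → EndsWith a w → w ≢ []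
EndsWith⇒≢[] ([]    , refl) ()
EndsWith⇒≢[] (_ ∷ _ , refl) ()

bispecial⇒Form : ∀ N {w} → length w < N → w ≢ [] → LeftSpecial w → RightSpecial w → Form w
bispecial⇒Form (suc N) {w} ∣w∣<N w≢[] ls rs with bispecial-shape w w≢[] ls rs
... | ⟨1⟩  = A 0
... | ⟨10⟩ = C 0
... | margins {ℓ} {β = β} c lm rm bs c1@(c₀ , c≡c₀1)
  with (ls′ , occ₁) , φv≡c ← LeftSpecial-lift c β lm bs c1 ls
     | rs′ , occ₂ ← RightSpecial-lift ℓ c rm bs c1 rs
  = subst (λ x → Form (ℓ ++ x ++ β)) φv≡c (Form-φ lm rm (bispecial⇒Form N ∣v∣<N v≢[] ls′ rs′) occ₁ occ₂)
  where
  v = unφ c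
  ∣v∣<N : length v < N
  ∣v∣<N = <-≤-trans (subst (λ x → length v < length x) φv≡c (length-φ-ending-1 v c₀ (trans φv≡c c≡c₀1)))
                    (≤-trans (length-Infix (ℓ , β , refl)) (≤-pred ∣w∣<N))
  v≢[] : v ≢ []
  v≢[] v≡[] = EndsWith⇒≢[] c1 (trans (sym φv≡c) (cong φ v≡[]))

_⊕_ : ℕ × ℕ × ℕ → ℕ × ℕ × ℕ → ℕ × ℕ × ℕ
(a , b , c) ⊕ (a′ , b′ , c′) = a + a′ , b + b′ , c + c′

⊕-comm : ∀ x y → x ⊕ y ≡ y ⊕ x
⊕-comm (a , b , c) (a′ , b′ , c′) = cong₂ _,_ (+-comm a a′) (cong₂ _,_ (+-comm b b′) (+-comm c c′))

count-∷ : ∀ l a u → count l (a ∷ u) ≡ count l [ a ] + count l u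
count-∷ l0 l0 u = refl
count-∷ l0 l1 u = refl
count-∷ l0 l2 u = refl
count-∷ l1 l0 u = refl
count-∷ l1 l1 u = refl
count-∷ l1 l2 u = refl
count-∷ l2 l0 u = refl
count-∷ l2 l1 u = refl
count-∷ l2 l2 u = refl

count-++ : ∀ l u v → count l (u ++ v) ≡ count l u + count l v
count-++ l []      v = refl
count-++ l (a ∷ u) v = begin
  count l (a ∷ u ++ v)                    ≡⟨ count-∷ l a (u ++ v) ⟩
  count l [ a ] + count l (u ++ v)        ≡⟨ cong (count l [ a ] +_) (count-++ l u v) ⟩
  count l [ a ] + (count l u + count l v) ≡⟨ +-assoc (count l [ a ]) (count l u) (count l v) ⟨
  (count l [ a ] + count l u) + count l v ≡⟨ cong (_+ count l v) (count-∷ l a u) ⟨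
  count l (a ∷ u) + count l v             ∎
  where open ≡-Reasoning

parikh-++ : ∀ u v → parikh (u ++ v) ≡ parikh u ⊕ parikh v
parikh-++ u v = cong₂ _,_ (count-++ l0 u v) (cong₂ _,_ (count-++ l1 u v) (count-++ l2 u v))

-- a record rather than parikh u ≡ parikh v, so that u and v are inferable from a proof
record _∼_ (u v : Word) : Set where
  constructor ⟨_⟩
  field parikh-≡ : parikh u ≡ parikh v
open _∼_

∼-setoid : Setoid _ _
∼-setoid = record
  { Carrier       = Word
  ; _≈_           = _∼_
  ; isEquivalence = record
    { refl  = ⟨ refl ⟩
    ; sym   = λ u∼v → ⟨ sym (parikh-≡ u∼v) ⟩
    ; trans = λ u∼v v∼w → ⟨ trans (parikh-≡ u∼v) (parikh-≡ v∼w) ⟩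
    }
  }

module ∼-Reasoning = SetoidReasoning ∼-setoid

∼-++-comm : ∀ u v → (u ++ v) ∼ (v ++ u)
∼-++-comm u v = ⟨ trans (parikh-++ u v) (trans (⊕-comm (parikh u) (parikh v)) (sym (parikh-++ v u))) ⟩

∼-++ : ∀ {u u′ v v′} → u ∼ u′ → v ∼ v′ → (u ++ v) ∼ (u′ ++ v′)
∼-++ {u} {u′} {v} {v′} u∼u′ v∼v′ =
  ⟨ trans (parikh-++ u v) (trans (cong₂ _⊕_ (parikh-≡ u∼u′) (parikh-≡ v∼v′)) (sym (parikh-++ u′ v′))) ⟩

∼-∷ : ∀ a {v v′} → v ∼ v′ → (a ∷ v) ∼ (a ∷ v′)
∼-∷ a = ∼-++ {[ a ]} ⟨ refl ⟩

Φ : ℕ × ℕ × ℕ → ℕ × ℕ × ℕ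
Φ (a , b , c) = a + c , a + b , b

count0-φ : ∀ u → count l0 (φ u) ≡ count l0 u + count l2 u
count0-φ []       = refl
count0-φ (l0 ∷ u) = cong suc (count0-φ u)
count0-φ (l1 ∷ u) = count0-φ u
count0-φ (l2 ∷ u) = trans (cong suc (count0-φ u)) (sym (+-suc (count l0 u) (count l2 u)))

count1-φ : ∀ u → count l1 (φ u) ≡ count l0 u + count l1 u
count1-φ []       = refl
count1-φ (l0 ∷ u) = cong suc (count1-φ u)
count1-φ (l1 ∷ u) = trans (cong suc (count1-φ u)) (sym (+-suc (count l0 u) (count l1 u)))
count1-φ (l2 ∷ u) = count1-φ u

count2-φ : ∀ u → count l2 (φ u) ≡ count l1 u
count2-φ []       = refl
count2-φ (l0 ∷ u) = count2-φ u
count2-φ (l1 ∷ u) = cong suc (count2-φ u)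
count2-φ (l2 ∷ u) = count2-φ u

parikh-φ : ∀ u → parikh (φ u) ≡ Φ (parikh u)
parikh-φ u = cong₂ _,_ (count0-φ u) (cong₂ _,_ (count1-φ u) (count2-φ u))

∼-φ : ∀ {u v} → u ∼ v → φ u ∼ φ v
∼-φ {u} {v} u∼v = ⟨ trans (parikh-φ u) (trans (cong Φ (parikh-≡ u∼v)) (sym (parikh-φ v))) ⟩

pB∼φpA∙0 : ∀ n → pB n ∼ (φ (pA n) ++ w0)
pB∼φpA∙0 zero    = ⟨ refl ⟩
pB∼φpA∙0 (suc n) = begin
  pB (suc n)                ≡⟨ pB-suc≡012∙φφpB n ⟩
  l0 ∷ l1 ∷ l2 ∷ Z          ≈⟨ ⟨ refl ⟩ ⟩
  l2 ∷ l1 ∷ w0 ++ Z         ≈⟨ ∼-∷ l2 (∼-∷ l1 (∼-++-comm w0 Z)) ⟩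
  l2 ∷ l1 ∷ Z ++ w0         ≡⟨ cong (λ x → φ x ++ w0) (pA-suc≡1∙φpB n) ⟨
  φ (pA (suc n)) ++ w0      ∎
  where
  open ∼-Reasoning
  Z = φ (φ (pB n))

wA∼pA : ∀ n → wA n ∼ pA n
wB∼pB : ∀ n → wB n ∼ pB n

wA∼pA zero    = ⟨ refl ⟩
wA∼pA (suc n) = begin
  wA (suc n)         ≡⟨ wA-suc≡1∙φwB n ⟩
  l1 ∷ φ (wB n)      ≈⟨ ∼-∷ l1 (∼-φ (wB∼pB n)) ⟩
  l1 ∷ φ (pB n)      ≡⟨ pA-suc≡1∙φpB n ⟨
  pA (suc n)         ∎
  where open ∼-Reasoning

wB∼pB n = begin
  wB n               ≡⟨ wB≡φwA∙0 n ⟩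
  φ (wA n) ++ w0     ≈⟨ ∼-++ (∼-φ (wA∼pA n)) ⟨ refl ⟩ ⟩
  φ (pA n) ++ w0     ≈⟨ pB∼φpA∙0 n ⟨
  pB n               ∎
  where open ∼-Reasoning

wC∼pC : ∀ n → wC n ∼ pC n
wD∼pD : ∀ n → wD n ∼ pD n

wC∼pC zero    = ⟨ refl ⟩
wC∼pC (suc n) = begin
  wC (suc n)               ≡⟨ wC-suc≡1∙φwD∙0 n ⟩
  l1 ∷ φ (wD n) ++ w0      ≈⟨ ∼-∷ l1 (∼-++ (∼-φ (wD∼pD n)) ⟨ refl ⟩) ⟩
  l1 ∷ φ (pD n) ++ w0      ≈⟨ ∼-∷ l1 (∼-++-comm (φ (pD n)) w0) ⟩
  l1 ∷ l0 ∷ φ (pD n)       ≈⟨ ⟨ refl ⟩ ⟩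
  w01 ++ φ (pD n)          ≡⟨ pC-suc≡01∙φpD n ⟨
  pC (suc n)               ∎
  where open ∼-Reasoning

wD∼pD n = begin
  wD n          ≡⟨ wD≡φwC n ⟩
  φ (wC n)      ≈⟨ ∼-φ (wC∼pC n) ⟩
  φ (pC n)      ≡⟨ pD≡φpC n ⟨
  pD n          ∎
  where open ∼-Reasoning

proposition9 : (w : Word) → Factor w → w ≢ [] → Bispecial w →
    (∃[ n ] (w ≡ wA n × parikh (wA n) ≡ parikh (pA n))) ⊎
    (∃[ n ] (w ≡ wB n × parikh (wB n) ≡ parikh (pB n))) ⊎
    (∃[ n ] (w ≡ wC n × parikh (wC n) ≡ parikh (pC n))) ⊎
    (∃[ n ] (w ≡ wD n × parikh (wD n) ≡ parikh (pD n)))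
proposition9 w _ w≢[] ((a , b , a≢b , occa , occb) , (c , d , c≢d , occc , occd))
  with bispecial⇒Form (suc (length w)) ≤-refl w≢[]
         (a , b , a≢b , Factor⇒Occurs occa , Factor⇒Occurs occb)
         (c , d , c≢d , Factor⇒Occurs occc , Factor⇒Occurs occd)
... | A n = inj₁ (n , refl , parikh-≡ (wA∼pA n))
... | B n = inj₂ (inj₁ (n , refl , parikh-≡ (wB∼pB n)))
... | C n = inj₂ (inj₂ (inj₁ (n , refl , parikh-≡ (wC∼pC n))))
... | D n = inj₂ (inj₂ (inj₂ (n , refl , parikh-≡ (wD∼pD n))))
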